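{- Let $\Gamma,\Sigma$ be finite alphabets. Any function $f:\mathrm{BinTree}(\Gamma)\to\mathrm{BinTree}(\Sigma)$ computed by a register tree transducer can be expressed in the simply typed $\lambda$-calculus by a closed term $t:\mathtt{BT}_\Gamma[A]\to\mathtt{BT}_\Sigma$ for some simple type $A$, i.e. $t\,\overline{T}=_\beta\overline{f(T)}$ for all $T\in\mathrm{BinTree}(\Gamma)$.
   Context: Trees: $\mathrm{BinTree}(\Sigma)$ is generated by $T,U::=\langle\rangle\mid a\langle T,U\rangle$ ($a\in\Sigma$); one-hole trees $\partial\mathrm{BinTree}(\Sigma)$ are generated by $T'::=\square\mid a\langle T',T\rangle\mid a\langle T,T'\rangle$; $T'[U]$ replaces $\square$ by $U$. Expressions over variable sets $V,V'$: $\mathrm{ExprBT}(\Sigma,V,V')$ is generated by $E,F::=\langle\rangle\mid x\mid a\langle E,F\rangle\mid E'[E]$ and $\mathrm{Expr}\partial\mathrm{BT}(\Sigma,V,V')$ by $E',F'::=\square\mid x'\mid a\langle E',E\rangle\mid a\langle E,E'\rangle\mid E'[F']$ ($x\in V$, $x'\in V'$, $a\in\Sigma$); given $\rho:V\to\mathrm{BinTree}(\Sigma)$ and $\rho':V'\to\partial\mathrm{BinTree}(\Sigma)$, $E(\rho,\rho')$ and $E'(\rho,\rho')$ are obtained by substituting values for variables and performing hole substitutions. A register tree transducer $\mathrm{BinTree}(\Gamma)\to\mathrm{BinTree}(\Sigma)$ consists of a finite set $Q$ of states with initial state $q_I$, disjoint finite sets $R,R'$ of registers, an output function $F:Q\to\mathrm{ExprBT}(\Sigma,R,R')$,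 and a transition function $\delta:Q\times Q\times\Gamma\to Q\times(R\to\mathrm{ExprBT}(\Sigma,R_{\triangleleft\triangleright},R'_{\triangleleft\triangleright}))\times(R'\to\mathrm{Expr}\partial\mathrm{BT}(\Sigma,R_{\triangleleft\triangleright},R'_{\triangleleft\triangleright}))$ where $R_{\triangleleft\triangleright}=R\times\{\triangleleft,\triangleright\}$, $R'_{\triangleleft\triangleright}=R'\times\{\triangleleft,\triangleright\}$. It assigns bottom-up to each subtree a configuration in $Q\times\mathrm{BinTree}(\Sigma)^R\times\partial\mathrm{BinTree}(\Sigma)^{R'}$: a leaf $\langle\rangle$ gets $(q_I,(r\mapsto\langle\rangle),(r'\mapsto\square))$; if $T$ and $U$ get $(q_\triangleleft,\rho_\triangleleft,\rho'_\triangleleft)$ and $(q_\triangleright,\rho_\triangleright,\rho'_\triangleright)$ and $\delta(q_\triangleleft,q_\triangleright,a)=(q,\psi,\psi')$, then $a\langle T,U\rangle$ gets $(q,(r\mapsto\psi(r)(\rho,\rho')),(r'\mapsto\psi'(r')(\rho,\rho')))$ where $\rho(r,z)=\rho_z(r)$ and $\rho'(r',z)=\rho'_z(r')$ for $z\in\{\triangleleft,\triangleright\}$. The output on a tree whose configuration is $(q,\rho,\rho')$ is $F(q)(\rho,\rho')$. Simply typed $\lambda$-calculus: simple types $A,B::=o\mid A\to B$ ($\to$ associates to the right, $A^n\to B$ means $n$ copies of $A$); terms $x\mid t\,u\mid\lambda x.\,t$ with the usual simple typing; $=_\beta$ generated by $(\lambda x.\,t)\,u=_\beta t\{x:=u\}$;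 $A[B]$ is $A$ with $o$ replaced by $B$. For $\Sigma=\{a_1,\dots,a_n\}$, $\mathtt{BT}_\Sigma=(o\to o\to o)^n\to o\to o$ and $T\in\mathrm{BinTree}(\Sigma)$ is encoded as $\overline{T}=\lambda f_1.\cdots\lambda f_n.\,\lambda x.\,\widehat{T}$ with $\widehat{\langle\rangle}=x$ and $\widehat{a_i\langle T,U\rangle}=f_i\,\widehat T\,\widehat U$. -}

module Defs where

open import Data.Nat using (ℕ; zero; suc; _∸_)
open import Data.Fin using (Fin; toℕ)
open import Data.Product using (_×_; _,_)
open import Data.List using (List; []; _∷_)

-- Trees over the alphabet Fin k  (letters a₁,…,a_k  ↔  0,…,k-1)

data BinTree (k : ℕ) : Set where
  leaf : BinTree k
  node : Fin k → BinTree k → BinTree k → BinTree k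

data OneHole (k : ℕ) : Set where
  hole  : OneHole k
  nodeL : Fin k → OneHole k → BinTree k → OneHole k
  nodeR : Fin k → BinTree k → OneHole k → OneHole k

plug : ∀ {k} → OneHole k → BinTree k → BinTree k
plug hole U = U
plug (nodeL a T' T) U = node a (plug T' U) T
plug (nodeR a T T') U = node a T (plug T' U)

plugH : ∀ {k} → OneHole k → OneHole k → OneHole k
plugH hole U' = U'
plugH (nodeL a T' T) U' = nodeL a (plugH T' U') T
plugH (nodeR a T T') U' = nodeR a T (plugH T' U')

mutual
  data ExprBT (k : ℕ) (V V' : Set) : Set where
    eps  : ExprBT k V V'
    var  : V → ExprBT k V V'
    node : Fin k → ExprBT k V V' → ExprBT k V V' → ExprBT k V V'
    app  : ExprDBT k V V' → ExprBT k V V' → ExprBT k V V'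

  data ExprDBT (k : ℕ) (V V' : Set) : Set where
    hole  : ExprDBT k V V'
    var'  : V' → ExprDBT k V V'
    nodeL : Fin k → ExprDBT k V V' → ExprBT k V V' → ExprDBT k V V'
    nodeR : Fin k → ExprBT k V V' → ExprDBT k V V' → ExprDBT k V V'
    comp  : ExprDBT k V V' → ExprDBT k V V' → ExprDBT k V V'

mutual
  evalE : ∀ {k V V'} → ExprBT k V V' → (V → BinTree k) → (V' → OneHole k) → BinTree k
  evalE eps ρ ρ' = leaf
  evalE (var x) ρ ρ' = ρ x
  evalE (node a E F) ρ ρ' = node a (evalE E ρ ρ') (evalE F ρ ρ')
  evalE (app E' E) ρ ρ' = plug (evalD E' ρ ρ') (evalE E ρ ρ')

  evalD : ∀ {k V V'} → ExprDBT k V V' → (V → BinTree k) → (V' → OneHole k) → OneHole k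
  evalD hole ρ ρ' = hole
  evalD (var' x') ρ ρ' = ρ' x'
  evalD (nodeL a E' E) ρ ρ' = nodeL a (evalD E' ρ ρ') (evalE E ρ ρ')
  evalD (nodeR a E E') ρ ρ' = nodeR a (evalE E ρ ρ') (evalD E' ρ ρ')
  evalD (comp E' F') ρ ρ' = plugH (evalD E' ρ ρ') (evalD F' ρ ρ')

data Dir : Set where
  ◁ ▷ : Dir

record RTT (n m : ℕ) : Set where
  field
    nQ nR nR' : ℕ
    qI  : Fin nQ
    out : Fin nQ → ExprBT m (Fin nR) (Fin nR')
    δ   : Fin nQ → Fin nQ → Fin n →
          Fin nQ
          × (Fin nR  → ExprBT  m (Fin nR × Dir) (Fin nR' × Dir))
          × (Fin nR' → ExprDBT m (Fin nR × Dir) (Fin nR' × Dir))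

module _ {n m : ℕ} (M : RTT n m) where
  open RTT M

  Config : Set
  Config = Fin nQ × (Fin nR → BinTree m) × (Fin nR' → OneHole m)

  merge : ∀ {X : Set} → X → X → Dir → X
  merge l r ◁ = l
  merge l r ▷ = r

  step : Fin n → Config → Config → Config
  step a (qL , ρL , ρL') (qR , ρR , ρR') with δ qL qR a
  ... | (q , ψ , ψ') =
    q , (λ r → evalE (ψ r) ρ ρ') , (λ r' → evalD (ψ' r') ρ ρ')
    where
    ρ : Fin nR × Dir → BinTree m
    ρ (r , z) = merge (ρL r) (ρR r) z
    ρ' : Fin nR' × Dir → OneHole m
    ρ' (r' , z) = merge (ρL' r') (ρR' r') z

  config : BinTree n → Config
  config leaf = qI , (λ _ → leaf) , (λ _ → hole)
  config (node a T U) = step a (config T) (config U)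

  runRTT : BinTree n → BinTree m
  runRTT T with config T
  ... | (q , ρ , ρ') = evalE (out q) ρ ρ'

infixr 7 _⇒_
data Ty : Set where
  o   : Ty
  _⇒_ : Ty → Ty → Ty

data Tm : Set where
  var : ℕ → Tm
  app : Tm → Tm → Tm
  lam : Tm → Tm

Ctx : Set
Ctx = List Ty

data _∋_∶_ : Ctx → ℕ → Ty → Set where
  here  : ∀ {Δ A} → (A ∷ Δ) ∋ zero ∶ A
  there : ∀ {Δ A B x} → Δ ∋ x ∶ A → (B ∷ Δ) ∋ suc x ∶ A

data _⊢_∶_ : Ctx → Tm → Ty → Set where
  ⊢var : ∀ {Δ x A} → Δ ∋ x ∶ A → Δ ⊢ var x ∶ A
  ⊢app : ∀ {Δ t u A B} → Δ ⊢ t ∶ (A ⇒ B) → Δ ⊢ u ∶ A → Δ ⊢ app t u ∶ B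
  ⊢lam : ∀ {Δ t A B} → (A ∷ Δ) ⊢ t ∶ B → Δ ⊢ lam t ∶ (A ⇒ B)

ext : (ℕ → ℕ) → ℕ → ℕ
ext ρ zero = zero
ext ρ (suc x) = suc (ρ x)

rename : (ℕ → ℕ) → Tm → Tm
rename ρ (var x) = var (ρ x)
rename ρ (app t u) = app (rename ρ t) (rename ρ u)
rename ρ (lam t) = lam (rename (ext ρ) t)

exts : (ℕ → Tm) → ℕ → Tm
exts σ zero = var zero
exts σ (suc x) = rename suc (σ x)

subst : (ℕ → Tm) → Tm → Tm
subst σ (var x) = σ x
subst σ (app t u) = app (subst σ t) (subst σ u)
subst σ (lam t) = lam (subst (exts σ) t)

single : Tm → ℕ → Tm
single u zero = u
single u (suc x) = var x

infix 4 _=β_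
data _=β_ : Tm → Tm → Set where
  β      : ∀ {t u} → app (lam t) u =β subst (single u) t
  reflβ  : ∀ {t} → t =β t
  symβ   : ∀ {t u} → t =β u → u =β t
  transβ : ∀ {t u v} → t =β u → u =β v → t =β v
  appβ   : ∀ {t t' u u'} → t =β t' → u =β u' → app t u =β app t' u'
  lamβ   : ∀ {t t'} → t =β t' → lam t =β lam t'

_[_]ty : Ty → Ty → Ty
o [ B ]ty = B
(A ⇒ C) [ B ]ty = (A [ B ]ty) ⇒ (C [ B ]ty)

arrows : ℕ → Ty → Ty → Ty
arrows zero A B = B
arrows (suc k) A B = A ⇒ arrows k A B

BT : ℕ → Ty
BT k = arrows k (o ⇒ o ⇒ o) (o ⇒ o)

-- Church encoding  T̄ = λf₁…λf_k.λx. T̂ ;  under these binders x = var 0 and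
-- f_{i+1} (letter i : Fin k) = var (k ∸ toℕ i)
lams : ℕ → Tm → Tm
lams zero t = t
lams (suc k) t = lam (lams k t)

hat : ∀ k → BinTree k → Tm
hat k leaf = var zero
hat k (node a T U) = app (app (var (k ∸ toℕ a)) (hat k T)) (hat k U)

encode : ∀ k → BinTree k → Tm
encode k T = lams (suc k) (hat k T)

-- A configuration (q, ρ, ρ') is represented in continuation-passing style by the term
--   λk₁…k_|Q|. k_q ⌜ρ(r₁)⌝ … ⌜ρ(r_|R|)⌝ H₁ … H_|R'|
-- of type Cfg = (o^|R| → (o → o)^|R'| → o)^|Q| → o, where ⌜T⌝ is T̂ over the binders of the
-- output encoding and Hᵢ is any term with Hᵢ ⌜U⌝ =β ⌜ρ'(r'ᵢ)[U]⌝. The leaf becomes a term of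
-- type Cfg, and a letter a a term of type Cfg → Cfg → Cfg that passes its left argument a
-- continuation, which passes its right argument a continuation, which calls the continuation
-- of δ(q◁, q▷, a) on the register expressions read as terms over both register sets.
-- Instantiating the Church-encoded input at Cfg with these terms folds the input tree into
-- (a representation of) its configuration, and applying that to the output expressions,
-- read as terms in the same way, yields the encoding of the output.

module Submission where

open import Defs
open import Data.Nat using (ℕ; zero; suc; _+_; _∸_; _<_; s≤s; z≤n)
open import Data.Nat.Properties using (+-suc; +-identityʳ; m∸n≤m)
open import Data.Fin using (Fin; toℕ; zero; suc)
open import Data.List using ([]; _∷_)
open import Data.Product using (Σ; _×_; _,_; proj₁; proj₂)
open import Level using (0ℓ)
open import Relation.Binary.Bundles using (Setoid)
import Relation.Binary.Reasoning.Setoid as SetoidReasoning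
open import Relation.Binary.PropositionalEquality
  using (_≡_; refl; sym; trans; cong; cong₂) renaming (subst to ≡-subst)

-- Substitution

≡⇒=β : ∀ {t u} → t ≡ u → t =β u
≡⇒=β refl = reflβ

=β-setoid : Setoid 0ℓ 0ℓ
=β-setoid = record
  { Carrier = Tm ; _≈_ = _=β_
  ; isEquivalence = record { refl = reflβ ; sym = symβ ; trans = transβ } }

module =β-Reasoning = SetoidReasoning =β-setoid

infixr 5 _•_
_•_ : Tm → (ℕ → Tm) → ℕ → Tm
(u • σ) zero = u
(u • σ) (suc x) = σ x

ext-cong : ∀ {ρ ρ'} → (∀ x → ρ x ≡ ρ' x) → ∀ x → ext ρ x ≡ ext ρ' x
ext-cong e zero = refl
ext-cong e (suc x) = cong suc (e x)

rename-cong : ∀ {ρ ρ'} → (∀ x → ρ x ≡ ρ' x) → ∀ t → rename ρ t ≡ rename ρ' t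
rename-cong e (var x) = cong var (e x)
rename-cong e (app t u) = cong₂ app (rename-cong e t) (rename-cong e u)
rename-cong e (lam t) = cong lam (rename-cong (ext-cong e) t)

exts-cong : ∀ {σ σ'} → (∀ x → σ x ≡ σ' x) → ∀ x → exts σ x ≡ exts σ' x
exts-cong e zero = refl
exts-cong e (suc x) = cong (rename suc) (e x)

subst-cong : ∀ {σ σ'} → (∀ x → σ x ≡ σ' x) → ∀ t → subst σ t ≡ subst σ' t
subst-cong e (var x) = e x
subst-cong e (app t u) = cong₂ app (subst-cong e t) (subst-cong e u)
subst-cong e (lam t) = cong lam (subst-cong (exts-cong e) t)

rename-rename : ∀ ρ ρ' t → rename ρ (rename ρ' t) ≡ rename (λ x → ρ (ρ' x)) t
rename-rename ρ ρ' (var x) = refl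
rename-rename ρ ρ' (app t u) = cong₂ app (rename-rename ρ ρ' t) (rename-rename ρ ρ' u)
rename-rename ρ ρ' (lam t) =
  cong lam (trans (rename-rename (ext ρ) (ext ρ') t)
                  (rename-cong (λ { zero → refl ; (suc x) → refl }) t))

subst-rename : ∀ σ ρ t → subst σ (rename ρ t) ≡ subst (λ x → σ (ρ x)) t
subst-rename σ ρ (var x) = refl
subst-rename σ ρ (app t u) = cong₂ app (subst-rename σ ρ t) (subst-rename σ ρ u)
subst-rename σ ρ (lam t) =
  cong lam (trans (subst-rename (exts σ) (ext ρ) t)
                  (subst-cong (λ { zero → refl ; (suc x) → refl }) t))

rename-subst : ∀ ρ σ t → rename ρ (subst σ t) ≡ subst (λ x → rename ρ (σ x)) t
rename-subst ρ σ (var x) = refl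
rename-subst ρ σ (app t u) = cong₂ app (rename-subst ρ σ t) (rename-subst ρ σ u)
rename-subst ρ σ (lam t) = cong lam (trans (rename-subst (ext ρ) (exts σ) t) (subst-cong ext-exts t))
  where
  ext-exts : ∀ x → rename (ext ρ) (exts σ x) ≡ exts (λ y → rename ρ (σ y)) x
  ext-exts zero = refl
  ext-exts (suc x) = trans (rename-rename (ext ρ) suc (σ x)) (sym (rename-rename suc ρ (σ x)))

subst-subst : ∀ σ τ t → subst σ (subst τ t) ≡ subst (λ x → subst σ (τ x)) t
subst-subst σ τ (var x) = refl
subst-subst σ τ (app t u) = cong₂ app (subst-subst σ τ t) (subst-subst σ τ u)
subst-subst σ τ (lam t) = cong lam (trans (subst-subst (exts σ) (exts τ) t) (subst-cong exts-exts t))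
  where
  exts-exts : ∀ x → subst (exts σ) (exts τ x) ≡ exts (λ y → subst σ (τ y)) x
  exts-exts zero = refl
  exts-exts (suc x) = trans (subst-rename (exts σ) suc (τ x)) (sym (rename-subst suc σ (τ x)))

subst-var : ∀ t → subst var t ≡ t
subst-var (var x) = refl
subst-var (app t u) = cong₂ app (subst-var t) (subst-var u)
subst-var (lam t) =
  cong lam (trans (subst-cong (λ { zero → refl ; (suc x) → refl }) t) (subst-var t))

rename-as-subst : ∀ ρ t → rename ρ t ≡ subst (λ x → var (ρ x)) t
rename-as-subst ρ (var x) = refl
rename-as-subst ρ (app t u) = cong₂ app (rename-as-subst ρ t) (rename-as-subst ρ u)
rename-as-subst ρ (lam t) =
  cong lam (trans (rename-as-subst (ext ρ) t) (subst-cong (λ { zero → refl ; (suc x) → refl }) t))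

rename-id : ∀ t → rename (λ x → x) t ≡ t
rename-id t = trans (rename-as-subst (λ x → x) t) (subst-var t)

β-subst : ∀ σ t u → app (subst σ (lam t)) u =β subst (u • σ) t
β-subst σ t u =
  transβ β (≡⇒=β (trans (subst-subst (single u) (exts σ) t) (subst-cong single-exts t)))
  where
  single-exts : ∀ x → subst (single u) (exts σ x) ≡ (u • σ) x
  single-exts zero = refl
  single-exts (suc x) = trans (subst-rename (single u) suc (σ x)) (subst-var (σ x))

-- Iterated abstraction and application

apps : (k : ℕ) → (Fin k → Tm) → Tm → Tm
apps zero f t = t
apps (suc k) f t = apps k (λ i → f (suc i)) (app t (f zero))

pushAll : (k : ℕ) → (Fin k → Tm) → (ℕ → Tm) → ℕ → Tm
pushAll zero f σ = σ
pushAll (suc k) f σ = pushAll k (λ i → f (suc i)) (f zero • σ)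

extsN : ℕ → (ℕ → Tm) → ℕ → Tm
extsN zero σ = σ
extsN (suc k) σ = exts (extsN k σ)

slot : (k : ℕ) → Fin k → ℕ
slot k i = k ∸ suc (toℕ i)

apps-cong : ∀ k {f g t u} → (∀ i → f i =β g i) → t =β u → apps k f t =β apps k g u
apps-cong zero p q = q
apps-cong (suc k) p q = apps-cong k (λ i → p (suc i)) (appβ q (p zero))

lams-cong : ∀ k {t u} → t =β u → lams k t =β lams k u
lams-cong zero p = p
lams-cong (suc k) p = lamβ (lams-cong k p)

lams-suc : ∀ k t → lams (suc k) t ≡ lams k (lam t)
lams-suc zero t = refl
lams-suc (suc k) t = cong lam (lams-suc k t)

subst-apps : ∀ k σ f t → subst σ (apps k f t) ≡ apps k (λ i → subst σ (f i)) (subst σ t)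
subst-apps zero σ f t = refl
subst-apps (suc k) σ f t = subst-apps k σ (λ i → f (suc i)) (app t (f zero))

extsN-exts : ∀ k σ x → extsN k (exts σ) x ≡ exts (extsN k σ) x
extsN-exts zero σ x = refl
extsN-exts (suc k) σ x = exts-cong (extsN-exts k σ) x

subst-lams : ∀ k σ t → subst σ (lams k t) ≡ lams k (subst (extsN k σ) t)
subst-lams zero σ t = refl
subst-lams (suc k) σ t =
  cong lam (trans (subst-lams k (exts σ) t) (cong (lams k) (subst-cong (extsN-exts k σ) t)))

extsN-< : ∀ k σ x → x < k → extsN k σ x ≡ var x
extsN-< (suc k) σ zero p = refl
extsN-< (suc k) σ (suc x) (s≤s p) = cong (rename suc) (extsN-< k σ x p)

extsN-+ : ∀ k σ x → extsN k σ (k + x) ≡ rename (k +_) (σ x)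
extsN-+ zero σ x = sym (rename-id (σ x))
extsN-+ (suc k) σ x = trans (cong (rename suc) (extsN-+ k σ x)) (rename-rename suc (k +_) (σ x))

apps-lams-β : ∀ k f σ t → apps k f (subst σ (lams k t)) =β subst (pushAll k f σ) t
apps-lams-β zero f σ t = reflβ
apps-lams-β (suc k) f σ t =
  transβ (apps-cong k (λ _ → reflβ) (β-subst σ (lams k t) (f zero)))
         (apps-lams-β k (λ i → f (suc i)) (f zero • σ) t)

pushAll-+ : ∀ k f σ x → pushAll k f σ (k + x) ≡ σ x
pushAll-+ zero f σ x = refl
pushAll-+ (suc k) f σ x =
  trans (cong (pushAll k _ _) (sym (+-suc k x)))
        (pushAll-+ k (λ i → f (suc i)) (f zero • σ) (suc x))

pushAll-slot : ∀ k f σ (i : Fin k) → pushAll k f σ (slot k i) ≡ f i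
pushAll-slot (suc k) f σ zero =
  trans (cong (pushAll k _ _) (sym (+-identityʳ k)))
        (pushAll-+ k (λ i → f (suc i)) (f zero • σ) 0)
pushAll-slot (suc k) f σ (suc i) = pushAll-slot k (λ i → f (suc i)) (f zero • σ) i

∸toℕ-slot : ∀ {k} (i : Fin k) → k ∸ toℕ i ≡ suc (slot k i)
∸toℕ-slot {suc k} zero = refl
∸toℕ-slot {suc k} (suc i) = ∸toℕ-slot i

pushCtx : ℕ → Ty → Ctx → Ctx
pushCtx zero A Δ = Δ
pushCtx (suc k) A Δ = pushCtx k A (A ∷ Δ)

∋-+ : ∀ k {A Δ x C} → Δ ∋ x ∶ C → pushCtx k A Δ ∋ k + x ∶ C
∋-+ zero p = p
∋-+ (suc k) {A} {Δ} {x} {C} p =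
  ≡-subst (λ i → pushCtx k A (A ∷ Δ) ∋ i ∶ C) (+-suc k x) (∋-+ k (there p))

∋-slot : ∀ k {A Δ} (i : Fin k) → pushCtx k A Δ ∋ slot k i ∶ A
∋-slot (suc k) {A} {Δ} zero =
  ≡-subst (λ i → pushCtx k A (A ∷ Δ) ∋ i ∶ A) (+-identityʳ k) (∋-+ k here)
∋-slot (suc k) (suc i) = ∋-slot k i

lams-⊢ : ∀ k {A B Δ t} → pushCtx k A Δ ⊢ t ∶ B → Δ ⊢ lams k t ∶ arrows k A B
lams-⊢ zero p = p
lams-⊢ (suc k) p = ⊢lam (lams-⊢ k p)

apps-⊢ : ∀ k {A B Δ f t} →
  Δ ⊢ t ∶ arrows k A B → (∀ i → Δ ⊢ f i ∶ A) → Δ ⊢ apps k f t ∶ B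
apps-⊢ zero p q = p
apps-⊢ (suc k) p q = apps-⊢ k (⊢app p (q zero)) (λ i → q (suc i))

rename-⊢ : ∀ {Δ Δ' ρ t A} →
  (∀ {x B} → Δ ∋ x ∶ B → Δ' ∋ ρ x ∶ B) → Δ ⊢ t ∶ A → Δ' ⊢ rename ρ t ∶ A
rename-⊢ f (⊢var p) = ⊢var (f p)
rename-⊢ f (⊢app p q) = ⊢app (rename-⊢ f p) (rename-⊢ f q)
rename-⊢ f (⊢lam p) = ⊢lam (rename-⊢ (λ { here → here ; (there q) → there (f q) }) p)

arrows-[]ty : ∀ k A B C → arrows k A B [ C ]ty ≡ arrows k (A [ C ]ty) (B [ C ]ty)
arrows-[]ty zero A B C = refl
arrows-[]ty (suc k) A B C = cong ((A [ C ]ty) ⇒_) (arrows-[]ty k A B C)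

-- Church encodings

foldTm : ∀ {k} → (Fin k → Tm) → Tm → BinTree k → Tm
foldTm S L leaf = L
foldTm S L (node a T U) = app (app (S a) (foldTm S L T)) (foldTm S L U)

subst-hat : ∀ {k} S L σ (T : BinTree k) → subst (L • pushAll k S σ) (hat k T) ≡ foldTm S L T
subst-hat S L σ leaf = refl
subst-hat {k} S L σ (node a T U) =
  cong₂ app (cong₂ app (trans (cong (L • pushAll k S σ) (∸toℕ-slot a)) (pushAll-slot k S σ a))
                       (subst-hat S L σ T))
            (subst-hat S L σ U)

hatHole : ∀ {m} → OneHole m → Tm → Tm
hatHole hole u = u
hatHole {m} (nodeL a T' T) u = app (app (var (m ∸ toℕ a)) (hatHole T' u)) (hat m T)
hatHole {m} (nodeR a T T') u = app (app (var (m ∸ toℕ a)) (hat m T)) (hatHole T' u)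

hat-plug : ∀ {m} (T' : OneHole m) U → hat m (plug T' U) ≡ hatHole T' (hat m U)
hat-plug hole U = refl
hat-plug (nodeL a T' T) U = cong (λ t → app (app _ t) _) (hat-plug T' U)
hat-plug (nodeR a T T') U = cong (app _) (hat-plug T' U)

hatHole-plugH : ∀ {m} (T' U' : OneHole m) u → hatHole (plugH T' U') u ≡ hatHole T' (hatHole U' u)
hatHole-plugH hole U' u = refl
hatHole-plugH (nodeL a T' T) U' u = cong (λ t → app (app _ t) _) (hatHole-plugH T' U' u)
hatHole-plugH (nodeR a T T') U' u = cong (app _) (hatHole-plugH T' U' u)

-- Register expressions as terms

record Env (m : ℕ) (V V' : Set) : Set where
  constructor mkEnv
  field
    nodeTm : Fin m → Tm
    leafTm : Tm
    regTm  : V → Tm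
    holeTm : V' → Tm

mapEnv : ∀ {m V V'} → (Tm → Tm) → Env m V V' → Env m V V'
mapEnv φ (mkEnv g x r h) = mkEnv (λ a → φ (g a)) (φ x) (λ v → φ (r v)) (λ v → φ (h v))

envAt : ∀ {m V V'} → (ℕ → ℕ) → (V → Tm) → (V' → Tm) → Env m V V'
envAt {m} w r h = mkEnv (λ a → var (w (m ∸ toℕ a))) (var (w 0)) r h

mutual
  codeE : ∀ {m V V'} → Env m V V' → ExprBT m V V' → Tm
  codeE e eps = Env.leafTm e
  codeE e (var v) = Env.regTm e v
  codeE e (node a E F) = app (app (Env.nodeTm e a) (codeE e E)) (codeE e F)
  codeE e (app E' E) = codeD e E' (codeE e E)

  codeD : ∀ {m V V'} → Env m V V' → ExprDBT m V V' → Tm → Tm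
  codeD e hole u = u
  codeD e (var' v) u = app (Env.holeTm e v) u
  codeD e (nodeL a E' E) u = app (app (Env.nodeTm e a) (codeD e E' u)) (codeE e E)
  codeD e (nodeR a E E') u = app (app (Env.nodeTm e a) (codeE e E)) (codeD e E' u)
  codeD e (comp E' F') u = codeD e E' (codeD e F' u)

mutual
  subst-codeE : ∀ {m V V'} σ (e : Env m V V') E →
    subst σ (codeE e E) ≡ codeE (mapEnv (subst σ) e) E
  subst-codeE σ e eps = refl
  subst-codeE σ e (var v) = refl
  subst-codeE σ e (node a E F) =
    cong₂ (λ t t' → app (app _ t) t') (subst-codeE σ e E) (subst-codeE σ e F)
  subst-codeE σ e (app E' E) =
    trans (subst-codeD σ e E' (codeE e E)) (cong (codeD _ E') (subst-codeE σ e E))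

  subst-codeD : ∀ {m V V'} σ (e : Env m V V') E' u →
    subst σ (codeD e E' u) ≡ codeD (mapEnv (subst σ) e) E' (subst σ u)
  subst-codeD σ e hole u = refl
  subst-codeD σ e (var' v) u = refl
  subst-codeD σ e (nodeL a E' E) u =
    cong₂ (λ t t' → app (app _ t) t') (subst-codeD σ e E' u) (subst-codeE σ e E)
  subst-codeD σ e (nodeR a E E') u =
    cong₂ (λ t t' → app (app _ t) t') (subst-codeE σ e E) (subst-codeD σ e E' u)
  subst-codeD σ e (comp E' F') u =
    trans (subst-codeD σ e E' (codeD e F' u)) (cong (codeD _ E') (subst-codeD σ e F' u))

record Realises {m V V'} (e : Env m V V') (ρ : V → BinTree m) (ρ' : V' → OneHole m) : Set where
  field
    nodeTm-ok : ∀ a → Env.nodeTm e a =β var (m ∸ toℕ a)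
    leafTm-ok : Env.leafTm e =β var 0
    regTm-ok  : ∀ v → Env.regTm e v =β hat m (ρ v)
    holeTm-ok : ∀ v u → app (Env.holeTm e v) u =β hatHole (ρ' v) u

mutual
  codeE-sound : ∀ {m V V'} {e : Env m V V'} {ρ ρ'} → Realises e ρ ρ' →
    ∀ E → codeE e E =β hat m (evalE E ρ ρ')
  codeE-sound ok eps = Realises.leafTm-ok ok
  codeE-sound ok (var v) = Realises.regTm-ok ok v
  codeE-sound ok (node a E F) =
    appβ (appβ (Realises.nodeTm-ok ok a) (codeE-sound ok E)) (codeE-sound ok F)
  codeE-sound {ρ = ρ} {ρ'} ok (app E' E) =
    transβ (codeD-sound ok E' (codeE-sound ok E))
           (≡⇒=β (sym (hat-plug (evalD E' ρ ρ') (evalE E ρ ρ'))))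

  codeD-sound : ∀ {m V V'} {e : Env m V V'} {ρ ρ'} → Realises e ρ ρ' →
    ∀ E' {t u} → t =β u → codeD e E' t =β hatHole (evalD E' ρ ρ') u
  codeD-sound ok hole p = p
  codeD-sound ok (var' v) {u = u} p = transβ (appβ reflβ p) (Realises.holeTm-ok ok v u)
  codeD-sound ok (nodeL a E' E) p =
    appβ (appβ (Realises.nodeTm-ok ok a) (codeD-sound ok E' p)) (codeE-sound ok E)
  codeD-sound ok (nodeR a E E') p =
    appβ (appβ (Realises.nodeTm-ok ok a) (codeE-sound ok E)) (codeD-sound ok E' p)
  codeD-sound {ρ = ρ} {ρ'} ok (comp E' F') {u = u} p =
    transβ (codeD-sound ok E' (codeD-sound ok F' p))
           (≡⇒=β (sym (hatHole-plugH (evalD E' ρ ρ') (evalD F' ρ ρ') u)))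

Realises-weaken : ∀ {m V V'} (e : Env m V V') θ u {ρ ρ'} →
  Realises (mapEnv (subst θ) e) ρ ρ' →
  Realises (mapEnv (subst (u • θ)) (mapEnv (rename suc) e)) ρ ρ'
Realises-weaken (mkEnv g x r h) θ u ok = record
  { nodeTm-ok = λ a → transβ (weaken (g a)) (nodeTm-ok a)
  ; leafTm-ok = transβ (weaken x) leafTm-ok
  ; regTm-ok  = λ v → transβ (weaken (r v)) (regTm-ok v)
  ; holeTm-ok = λ v u' → transβ (appβ (weaken (h v)) reflβ) (holeTm-ok v u') }
  where
  open Realises ok
  weaken : ∀ t → subst (u • θ) (rename suc t) =β subst θ t
  weaken t = ≡⇒=β (subst-rename (u • θ) suc t)

record FixesChurchVars (m : ℕ) (σ : ℕ → Tm) : Set where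
  field
    fixes-leaf : σ 0 ≡ var 0
    fixes-node : ∀ (a : Fin m) → σ (m ∸ toℕ a) ≡ var (m ∸ toℕ a)

FixesChurchVars-≗ : ∀ {m σ σ'} →
  (∀ x → σ x ≡ σ' x) → FixesChurchVars m σ → FixesChurchVars m σ'
FixesChurchVars-≗ eq fix = record
  { fixes-leaf = trans (sym (eq 0)) fixes-leaf
  ; fixes-node = λ a → trans (sym (eq _)) (fixes-node a) }
  where open FixesChurchVars fix

envAt-realises : ∀ {m V V'} θ w (r : V → Tm) (h : V' → Tm) {ρ ρ'} →
  FixesChurchVars m (λ i → θ (w i)) →
  (∀ v → subst θ (r v) =β hat m (ρ v)) →
  (∀ v u → app (subst θ (h v)) u =β hatHole (ρ' v) u) →
  Realises (mapEnv (subst θ) (envAt w r h)) ρ ρ'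
envAt-realises θ w r h fix r-ok h-ok = record
  { nodeTm-ok = λ a → ≡⇒=β (fixes-node a)
  ; leafTm-ok = ≡⇒=β fixes-leaf
  ; regTm-ok = r-ok
  ; holeTm-ok = h-ok }
  where open FixesChurchVars fix

record EnvTyped {m V V'} (Δ : Ctx) (e : Env m V V') : Set where
  field
    nodeTm-⊢ : ∀ a → Δ ⊢ Env.nodeTm e a ∶ (o ⇒ o ⇒ o)
    leafTm-⊢ : Δ ⊢ Env.leafTm e ∶ o
    regTm-⊢  : ∀ v → Δ ⊢ Env.regTm e v ∶ o
    holeTm-⊢ : ∀ v → Δ ⊢ Env.holeTm e v ∶ (o ⇒ o)

EnvTyped-weaken : ∀ {m V V' Δ B} {e : Env m V V'} →
  EnvTyped Δ e → EnvTyped (B ∷ Δ) (mapEnv (rename suc) e)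
EnvTyped-weaken {e = mkEnv g x r h} t = record
  { nodeTm-⊢ = λ a → rename-⊢ there (nodeTm-⊢ a)
  ; leafTm-⊢ = rename-⊢ there leafTm-⊢
  ; regTm-⊢  = λ v → rename-⊢ there (regTm-⊢ v)
  ; holeTm-⊢ = λ v → rename-⊢ there (holeTm-⊢ v) }
  where open EnvTyped t

mutual
  codeE-⊢ : ∀ {m V V' Δ} {e : Env m V V'} → EnvTyped Δ e → ∀ E → Δ ⊢ codeE e E ∶ o
  codeE-⊢ t eps = EnvTyped.leafTm-⊢ t
  codeE-⊢ t (var v) = EnvTyped.regTm-⊢ t v
  codeE-⊢ t (node a E F) = ⊢app (⊢app (EnvTyped.nodeTm-⊢ t a) (codeE-⊢ t E)) (codeE-⊢ t F)
  codeE-⊢ t (app E' E) = codeD-⊢ t E' (codeE-⊢ t E)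

  codeD-⊢ : ∀ {m V V' Δ} {e : Env m V V'} → EnvTyped Δ e →
    ∀ E' {u} → Δ ⊢ u ∶ o → Δ ⊢ codeD e E' u ∶ o
  codeD-⊢ t hole p = p
  codeD-⊢ t (var' v) p = ⊢app (EnvTyped.holeTm-⊢ t v) p
  codeD-⊢ t (nodeL a E' E) p =
    ⊢app (⊢app (EnvTyped.nodeTm-⊢ t a) (codeD-⊢ t E' p)) (codeE-⊢ t E)
  codeD-⊢ t (nodeR a E E') p =
    ⊢app (⊢app (EnvTyped.nodeTm-⊢ t a) (codeE-⊢ t E)) (codeD-⊢ t E' p)
  codeD-⊢ t (comp E' F') p = codeD-⊢ t E' (codeD-⊢ t F' p)

envAt-⊢ : ∀ {m V V' Δ} w (r : V → Tm) (h : V' → Tm) →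
  (∀ (a : Fin m) → Δ ∋ w (m ∸ toℕ a) ∶ (o ⇒ o ⇒ o)) → Δ ∋ w 0 ∶ o →
  (∀ v → Δ ⊢ r v ∶ o) → (∀ v → Δ ⊢ h v ∶ (o ⇒ o)) → EnvTyped Δ (envAt {m} w r h)
envAt-⊢ w r h node-∋ leaf-∋ r-⊢ h-⊢ = record
  { nodeTm-⊢ = λ a → ⊢var (node-∋ a) ; leafTm-⊢ = ⊢var leaf-∋
  ; regTm-⊢ = r-⊢ ; holeTm-⊢ = h-⊢ }

module Encoding {n m : ℕ} (M : RTT n m) where
  open RTT M

  Reg₂ Hole₂ : Set
  Reg₂ = Fin nR × Dir
  Hole₂ = Fin nR' × Dir

  Transition : Set
  Transition = Fin nQ × (Fin nR → ExprBT m Reg₂ Hole₂) × (Fin nR' → ExprDBT m Reg₂ Hole₂)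

  Hole Kont Cfg : Ty
  Hole = o ⇒ o
  Kont = arrows nR o (arrows nR' Hole o)
  Cfg = arrows nQ Kont o

  kont : Tm → Tm
  kont t = lams nR (lams nR' t)

  regIx : Fin nR → ℕ
  regIx r = nR' + slot nR r

  holeIx : Fin nR' → ℕ
  holeIx r' = slot nR' r'

  outerIx : ℕ → ℕ
  outerIx x = nR' + (nR + x)

  bind : (ℕ → Tm) → (Fin nR → Tm) → (Fin nR' → Tm) → ℕ → Tm
  bind θ R H = pushAll nR' H (pushAll nR R θ)

  kont-β : ∀ θ R H t → apps nR' H (apps nR R (subst θ (kont t))) =β subst (bind θ R H) t
  kont-β θ R H t =
    transβ (apps-cong nR' (λ _ → reflβ) (apps-lams-β nR R θ (lams nR' t)))
           (apps-lams-β nR' H (pushAll nR R θ) t)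

  bind-outer : ∀ θ R H x → bind θ R H (outerIx x) ≡ θ x
  bind-outer θ R H x = trans (pushAll-+ nR' H _ (nR + x)) (pushAll-+ nR R θ x)

  bind-reg : ∀ θ R H r → bind θ R H (regIx r) ≡ R r
  bind-reg θ R H r = trans (pushAll-+ nR' H _ (slot nR r)) (pushAll-slot nR R θ r)

  bind-hole : ∀ θ R H r' → bind θ R H (holeIx r') ≡ H r'
  bind-hole θ R H r' = pushAll-slot nR' H _ r'

  -- The terms below live under the binders λt.λf₁…λf_m.λx of transducerTm: x is variable 0,
  -- the constructor f of letter a is m ∸ toℕ a, and the input t is suc m + 0.
  leafBody : Tm
  leafBody = apps nR' (λ _ → lam (var 0)) (apps nR (λ _ → var (nQ + 0)) (var (slot nQ qI)))

  leafCfg : Tm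
  leafCfg = lams nQ leafBody

  regArg : Reg₂ → Tm
  regArg (r , ◁) = var (outerIx (regIx r))
  regArg (r , ▷) = var (regIx r)

  holeArg : Hole₂ → Tm
  holeArg (r' , ◁) = var (outerIx (holeIx r'))
  holeArg (r' , ▷) = var (holeIx r')

  -- Inside rightBody, under the register binders of both children, the continuations and
  -- the arguments cL, cR of stepCfg, variable x of the enclosing context has index stepOuterIx x.
  stepOuterIx : ℕ → ℕ
  stepOuterIx x = outerIx (outerIx (nQ + (2 + x)))

  stepEnv : Env m Reg₂ Hole₂
  stepEnv = envAt stepOuterIx regArg holeArg

  holeFn : (Fin nR' → ExprDBT m Reg₂ Hole₂) → Fin nR' → Tm
  holeFn ψ' r' = lam (codeD (mapEnv (rename suc) stepEnv) (ψ' r') (var 0))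

  rightBody : Transition → Tm
  rightBody (q , ψ , ψ') =
    apps nR' (holeFn ψ') (apps nR (λ r → codeE stepEnv (ψ r)) (var (outerIx (outerIx (slot nQ q)))))

  leftBody : Fin n → Fin nQ → Tm
  leftBody a qL = apps nQ (λ qR → kont (rightBody (δ qL qR a))) (var (outerIx (nQ + 0)))

  stepBody : Fin n → Tm
  stepBody a = apps nQ (λ qL → kont (leftBody a qL)) (var (nQ + 1))

  stepCfg : Fin n → Tm
  stepCfg a = lams (2 + nQ) (stepBody a)

  outEnv : Env m (Fin nR) (Fin nR')
  outEnv = envAt outerIx (λ r → var (regIx r)) (λ r' → var (holeIx r'))

  outBody : Fin nQ → Tm
  outBody q = codeE outEnv (out q)

  body : Tm
  body = apps nQ (λ q → kont (outBody q)) (app (apps n stepCfg (var (suc m + 0))) leafCfg)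

  transducerTm : Tm
  transducerTm = lam (lams (suc m) body)

  mergeRegs : (Fin nR → BinTree m) → (Fin nR → BinTree m) → Reg₂ → BinTree m
  mergeRegs ρL ρR (r , z) = merge M (ρL r) (ρR r) z

  mergeHoles : (Fin nR' → OneHole m) → (Fin nR' → OneHole m) → Hole₂ → OneHole m
  mergeHoles ρL' ρR' (r' , z) = merge M (ρL' r') (ρR' r') z

  registers : (Fin nR → BinTree m) → Fin nR → Tm
  registers ρ r = hat m (ρ r)

  Encodes : (Fin nR' → Tm) → (Fin nR' → OneHole m) → Set
  Encodes H ρ' = ∀ r' u → app (H r') u =β hatHole (ρ' r') u

  record WithHoles (ρ' : Fin nR' → OneHole m) (P : (Fin nR' → Tm) → Set) : Set where
    field
      holes    : Fin nR' → Tm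
      holes-ok : Encodes holes ρ'
      holds    : P holes

  output : Config M → BinTree m
  output (q , ρ , ρ') = evalE (out q) ρ ρ'

  module Semantics (τ : ℕ → Tm) (τ-fixes : FixesChurchVars m τ) where
    open =β-Reasoning

    -- The hole terms built by a step depend on the continuations, hence they come after ks.
    Represents : Tm → Config M → Set
    Represents c (q , ρ , ρ') =
      ∀ ks → WithHoles ρ' λ H → apps nQ ks c =β apps nR' H (apps nR (registers ρ) (ks q))

    Represents-kont : ∀ {c q ρ ρ'} → Represents c (q , ρ , ρ') → ∀ θ (B : Fin nQ → Tm) →
      WithHoles ρ' λ H →
        apps nQ (λ q' → subst θ (kont (B q'))) c =β subst (bind θ (registers ρ) H) (B q)
    Represents-kont {q = q} {ρ} rep θ B = record
      { holes = holes ; holes-ok = holes-ok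
      ; holds = transβ holds (kont-β θ (registers ρ) holes (B q)) }
      where
      ks : Fin nQ → Tm
      ks q' = subst θ (kont (B q'))
      open WithHoles (rep ks)

    leaf-represents : Represents (subst τ leafCfg) (config M leaf)
    leaf-represents ks = record
      { holes = λ _ → lam (var 0)
      ; holes-ok = λ _ _ → β
      ; holds =
          begin
            apps nQ ks (subst τ leafCfg)
          ≈⟨ apps-lams-β nQ ks τ leafBody ⟩
            subst θ leafBody
          ≡⟨ trans (subst-apps nR' θ _ _) (cong (apps nR' _) (subst-apps nR θ _ _)) ⟩
            apps nR' (λ _ → lam (var 0)) (apps nR (λ _ → θ (nQ + 0)) (θ (slot nQ qI)))
          ≈⟨ apps-cong nR' (λ _ → reflβ)
               (apps-cong nR (λ _ → ≡⇒=β x-fixed) (≡⇒=β (pushAll-slot nQ ks τ qI))) ⟩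
            apps nR' (λ _ → lam (var 0)) (apps nR (λ _ → var 0) (ks qI))
          ∎ }
      where
      θ : ℕ → Tm
      θ = pushAll nQ ks τ
      x-fixed : θ (nQ + 0) ≡ var 0
      x-fixed = trans (pushAll-+ nQ ks τ 0) (FixesChurchVars.fixes-leaf τ-fixes)

    step-represents : ∀ a {cL cR} cfgL cfgR → Represents cL cfgL → Represents cR cfgR →
      Represents (app (app (subst τ (stepCfg a)) cL) cR) (step M a cfgL cfgR)
    step-represents a {cL} {cR} (qL , ρL , ρL') (qR , ρR , ρR') repL repR ks = record
      { holes = Hnew ; holes-ok = Hnew-ok ; holds = unfolds }
      where
      q : Fin nQ
      q = proj₁ (δ qL qR a)
      ψ : Fin nR → ExprBT m Reg₂ Hole₂
      ψ = proj₁ (proj₂ (δ qL qR a))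
      ψ' : Fin nR' → ExprDBT m Reg₂ Hole₂
      ψ' = proj₂ (proj₂ (δ qL qR a))
      ρ : Reg₂ → BinTree m
      ρ = mergeRegs ρL ρR
      ρ' : Hole₂ → OneHole m
      ρ' = mergeHoles ρL' ρR'

      θ₁ : ℕ → Tm
      θ₁ = pushAll nQ ks (cR • cL • τ)
      open WithHoles (Represents-kont repL θ₁ (leftBody a))
        renaming (holes to HL; holes-ok to HL-ok; holds to left-unfolds)
      θ₃ : ℕ → Tm
      θ₃ = bind θ₁ (registers ρL) HL
      open WithHoles (Represents-kont repR θ₃ (λ qR' → rightBody (δ qL qR' a)))
        renaming (holes to HR; holes-ok to HR-ok; holds to right-unfolds)
      θ₅ : ℕ → Tm
      θ₅ = bind θ₃ (registers ρR) HR

      θ₅-outer : ∀ x → θ₅ (outerIx (outerIx x)) ≡ θ₁ x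
      θ₅-outer x = trans (bind-outer θ₃ _ HR (outerIx x)) (bind-outer θ₁ _ HL x)

      θ₅-left : ∀ x → θ₅ (outerIx x) ≡ θ₃ x
      θ₅-left = bind-outer θ₃ _ HR

      realises : Realises (mapEnv (subst θ₅) stepEnv) ρ ρ'
      realises = envAt-realises θ₅ stepOuterIx regArg holeArg
        (FixesChurchVars-≗ (λ i → sym (trans (θ₅-outer _) (pushAll-+ nQ ks _ (2 + i)))) τ-fixes)
        (λ { (r , ◁) → ≡⇒=β (trans (θ₅-left _) (bind-reg θ₁ _ HL r))
           ; (r , ▷) → ≡⇒=β (bind-reg θ₃ _ HR r) })
        (λ { (r' , ◁) u →
               transβ (appβ (≡⇒=β (trans (θ₅-left _) (bind-hole θ₁ _ HL r'))) reflβ) (HL-ok r' u)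
           ; (r' , ▷) u → transβ (appβ (≡⇒=β (bind-hole θ₃ _ HR r')) reflβ) (HR-ok r' u) })

      Hnew : Fin nR' → Tm
      Hnew r' = subst θ₅ (holeFn ψ' r')

      Hnew-ok : Encodes Hnew (λ r' → evalD (ψ' r') ρ ρ')
      Hnew-ok r' u =
        begin
          app (Hnew r') u
        ≈⟨ β-subst θ₅ (codeD (mapEnv (rename suc) stepEnv) (ψ' r') (var 0)) u ⟩
          subst (u • θ₅) (codeD (mapEnv (rename suc) stepEnv) (ψ' r') (var 0))
        ≡⟨ subst-codeD (u • θ₅) _ (ψ' r') (var 0) ⟩
          codeD (mapEnv (subst (u • θ₅)) (mapEnv (rename suc) stepEnv)) (ψ' r') u
        ≈⟨ codeD-sound (Realises-weaken stepEnv θ₅ u realises) (ψ' r') reflβ ⟩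
          hatHole (evalD (ψ' r') ρ ρ') u
        ∎

      newRegisters : Fin nR → Tm
      newRegisters = registers (λ r → evalE (ψ r) ρ ρ')

      enter-left : subst θ₁ (stepBody a) ≡ apps nQ (λ qL' → subst θ₁ (kont (leftBody a qL'))) cL
      enter-left = trans (subst-apps nQ θ₁ _ _) (cong (apps nQ _) (pushAll-+ nQ ks _ 1))

      enter-right : subst θ₃ (leftBody a qL) ≡
                    apps nQ (λ qR' → subst θ₃ (kont (rightBody (δ qL qR' a)))) cR
      enter-right =
        trans (subst-apps nQ θ₃ _ _)
              (cong (apps nQ _) (trans (bind-outer θ₁ _ HL _) (pushAll-+ nQ ks _ 0)))

      continue : subst θ₅ (rightBody (δ qL qR a)) =β apps nR' Hnew (apps nR newRegisters (ks q))
      continue =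
        transβ (≡⇒=β (trans (subst-apps nR' θ₅ _ _)
                            (cong (apps nR' Hnew) (subst-apps nR θ₅ _ _))))
          (apps-cong nR' (λ _ → reflβ)
            (apps-cong nR (λ r → transβ (≡⇒=β (subst-codeE θ₅ stepEnv (ψ r)))
                                        (codeE-sound realises (ψ r)))
                          (≡⇒=β (trans (θ₅-outer _) (pushAll-slot nQ ks _ q)))))

      arguments : Fin (2 + nQ) → Tm
      arguments zero = cL
      arguments (suc zero) = cR
      arguments (suc (suc i)) = ks i

      unfolds : apps nQ ks (app (app (subst τ (stepCfg a)) cL) cR) =β
                apps nR' Hnew (apps nR newRegisters (ks q))
      unfolds =
        begin
          apps nQ ks (app (app (subst τ (stepCfg a)) cL) cR)
        ≈⟨ apps-lams-β (2 + nQ) arguments τ (stepBody a) ⟩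
          subst θ₁ (stepBody a)
        ≡⟨ enter-left ⟩
          apps nQ (λ qL' → subst θ₁ (kont (leftBody a qL'))) cL
        ≈⟨ left-unfolds ⟩
          subst θ₃ (leftBody a qL)
        ≡⟨ enter-right ⟩
          apps nQ (λ qR' → subst θ₃ (kont (rightBody (δ qL qR' a)))) cR
        ≈⟨ right-unfolds ⟩
          subst θ₅ (rightBody (δ qL qR a))
        ≈⟨ continue ⟩
          apps nR' Hnew (apps nR newRegisters (ks q))
        ∎

    represents : ∀ T →
      Represents (foldTm (λ a → subst τ (stepCfg a)) (subst τ leafCfg) T) (config M T)
    represents leaf = leaf-represents
    represents (node a T U) =
      step-represents a (config M T) (config M U) (represents T) (represents U)

    output-represents : ∀ {c} cfg → Represents c cfg →
      apps nQ (λ q → subst τ (kont (outBody q))) c =β hat m (output cfg)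
    output-represents (q , ρ , ρ') rep = transβ holds
      (transβ (≡⇒=β (subst-codeE θ outEnv (out q))) (codeE-sound realises (out q)))
      where
      open WithHoles (Represents-kont rep τ outBody)
      θ : ℕ → Tm
      θ = bind τ (registers ρ) holes
      realises : Realises (mapEnv (subst θ) outEnv) ρ ρ'
      realises = envAt-realises θ outerIx _ _
        (FixesChurchVars-≗ (λ i → sym (bind-outer τ _ holes i)) τ-fixes)
        (λ r → ≡⇒=β (bind-reg τ _ holes r))
        (λ r' u → transβ (appβ (≡⇒=β (bind-hole τ _ holes r')) reflβ) (holes-ok r' u))

  transducer-correct : ∀ T → app transducerTm (encode n T) =β encode m (runRTT M T)
  transducer-correct T =
    begin
      app transducerTm (encode n T)
    ≈⟨ β ⟩
      subst (single (encode n T)) (lams (suc m) body)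
    ≡⟨ subst-lams (suc m) (single (encode n T)) body ⟩
      lams (suc m) (subst τ body)
    ≈⟨ lams-cong (suc m) body-evaluates ⟩
      encode m (runRTT M T)
    ∎
    where
    open =β-Reasoning

    τ : ℕ → Tm
    τ = extsN (suc m) (single (encode n T))

    τ-fixes : FixesChurchVars m τ
    τ-fixes = record
      { fixes-leaf = extsN-< (suc m) (single (encode n T)) 0 (s≤s z≤n)
      ; fixes-node = λ a → extsN-< (suc m) (single (encode n T)) _ (s≤s (m∸n≤m m (toℕ a))) }

    open Semantics τ τ-fixes

    S : Fin n → Tm
    S a = subst τ (stepCfg a)

    L : Tm
    L = subst τ leafCfg

    K : Fin nQ → Tm
    K q = subst τ (kont (outBody q))

    weaken : ℕ → Tm
    weaken x = var (suc m + x)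

    input : τ (suc m + 0) ≡ subst weaken (lams n (lam (hat n T)))
    input = trans (extsN-+ (suc m) _ 0)
      (trans (rename-as-subst (suc m +_) (encode n T)) (cong (subst weaken) (lams-suc n (hat n T))))

    input-folds : app (apps n S (τ (suc m + 0))) L =β foldTm S L T
    input-folds =
      begin
        app (apps n S (τ (suc m + 0))) L
      ≡⟨ cong (λ t → app (apps n S t) L) input ⟩
        app (apps n S (subst weaken (lams n (lam (hat n T))))) L
      ≈⟨ appβ (apps-lams-β n S weaken (lam (hat n T))) reflβ ⟩
        app (subst (pushAll n S weaken) (lam (hat n T))) L
      ≈⟨ β-subst (pushAll n S weaken) (hat n T) L ⟩
        subst (L • pushAll n S weaken) (hat n T)
      ≡⟨ subst-hat S L weaken T ⟩
        foldTm S L T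
      ∎

    body-evaluates : subst τ body =β hat m (runRTT M T)
    body-evaluates =
      begin
        subst τ body
      ≡⟨ trans (subst-apps nQ τ _ _) (cong (λ t → apps nQ K (app t L)) (subst-apps n τ stepCfg _)) ⟩
        apps nQ K (app (apps n S (τ (suc m + 0))) L)
      ≈⟨ apps-cong nQ (λ _ → reflβ) input-folds ⟩
        apps nQ K (foldTm S L T)
      ≈⟨ output-represents (config M T) (represents T) ⟩
        hat m (runRTT M T)
      ∎

  Input : Ty
  Input = arrows n (Cfg ⇒ Cfg ⇒ Cfg) (Cfg ⇒ Cfg)

  Δout : Ctx
  Δout = o ∷ pushCtx m (o ⇒ o ⇒ o) (Input ∷ [])

  frameCtx : Ctx → Ctx
  frameCtx Δ = pushCtx nR' Hole (pushCtx nR o Δ)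

  kont-⊢ : ∀ {Δ t} → frameCtx Δ ⊢ t ∶ o → Δ ⊢ kont t ∶ Kont
  kont-⊢ p = lams-⊢ nR (lams-⊢ nR' p)

  outer-∋ : ∀ {Δ x A} → Δ ∋ x ∶ A → frameCtx Δ ∋ outerIx x ∶ A
  outer-∋ p = ∋-+ nR' (∋-+ nR p)

  reg-∋ : ∀ {Δ} r → frameCtx Δ ∋ regIx r ∶ o
  reg-∋ r = ∋-+ nR' (∋-slot nR r)

  hole-∋ : ∀ {Δ} r' → frameCtx Δ ∋ holeIx r' ∶ Hole
  hole-∋ r' = ∋-slot nR' r'

  node-∋ : ∀ (a : Fin m) → Δout ∋ m ∸ toℕ a ∶ (o ⇒ o ⇒ o)
  node-∋ a =
    ≡-subst (λ i → Δout ∋ i ∶ (o ⇒ o ⇒ o)) (sym (∸toℕ-slot a)) (there (∋-slot m a))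

  Δstep : Ctx
  Δstep = pushCtx nQ Kont (Cfg ∷ Cfg ∷ Δout)

  stepEnv-⊢ : EnvTyped (frameCtx (frameCtx Δstep)) stepEnv
  stepEnv-⊢ = envAt-⊢ stepOuterIx regArg holeArg (λ a → lift (node-∋ a)) (lift here)
    (λ { (r , ◁) → ⊢var (outer-∋ (reg-∋ r)) ; (r , ▷) → ⊢var (reg-∋ r) })
    (λ { (r' , ◁) → ⊢var (outer-∋ (hole-∋ r')) ; (r' , ▷) → ⊢var (hole-∋ r') })
    where
    lift : ∀ {x A} → Δout ∋ x ∶ A → frameCtx (frameCtx Δstep) ∋ stepOuterIx x ∶ A
    lift p = outer-∋ (outer-∋ (∋-+ nQ (there (there p))))

  rightBody-⊢ : ∀ d → frameCtx (frameCtx Δstep) ⊢ rightBody d ∶ o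
  rightBody-⊢ (q , ψ , ψ') =
    apps-⊢ nR' (apps-⊢ nR (⊢var (outer-∋ (outer-∋ (∋-slot nQ q))))
                          (λ r → codeE-⊢ stepEnv-⊢ (ψ r)))
      (λ r' → ⊢lam (codeD-⊢ (EnvTyped-weaken stepEnv-⊢) (ψ' r') (⊢var here)))

  leftBody-⊢ : ∀ a qL → frameCtx Δstep ⊢ leftBody a qL ∶ o
  leftBody-⊢ a qL =
    apps-⊢ nQ (⊢var (outer-∋ (∋-+ nQ here))) (λ qR → kont-⊢ (rightBody-⊢ (δ qL qR a)))

  stepCfg-⊢ : ∀ a → Δout ⊢ stepCfg a ∶ (Cfg ⇒ Cfg ⇒ Cfg)
  stepCfg-⊢ a = ⊢lam (⊢lam (lams-⊢ nQ
    (apps-⊢ nQ (⊢var (∋-+ nQ (there here))) (λ qL → kont-⊢ (leftBody-⊢ a qL)))))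

  leafCfg-⊢ : Δout ⊢ leafCfg ∶ Cfg
  leafCfg-⊢ = lams-⊢ nQ
    (apps-⊢ nR' (apps-⊢ nR (⊢var (∋-slot nQ qI)) (λ _ → ⊢var (∋-+ nQ here)))
                (λ _ → ⊢lam (⊢var here)))

  outEnv-⊢ : EnvTyped (frameCtx Δout) outEnv
  outEnv-⊢ = envAt-⊢ outerIx _ _ (λ a → outer-∋ (node-∋ a)) (outer-∋ here)
    (λ r → ⊢var (reg-∋ r)) (λ r' → ⊢var (hole-∋ r'))

  body-⊢ : Δout ⊢ body ∶ o
  body-⊢ = apps-⊢ nQ (⊢app (apps-⊢ n (⊢var (there (∋-+ m here))) stepCfg-⊢) leafCfg-⊢)
    (λ q → kont-⊢ (codeE-⊢ outEnv-⊢ (out q)))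

  transducerTm-⊢ : [] ⊢ transducerTm ∶ (BT n [ Cfg ]ty ⇒ BT m)
  transducerTm-⊢ =
    ≡-subst (λ A → [] ⊢ transducerTm ∶ (A ⇒ BT m)) (sym (arrows-[]ty n (o ⇒ o ⇒ o) (o ⇒ o) Cfg))
      (⊢lam (≡-subst (λ t → (Input ∷ []) ⊢ t ∶ BT m) (sym (lams-suc m body))
                     (lams-⊢ m (⊢lam body-⊢))))

theorem34 : (n m : ℕ) (f : BinTree n → BinTree m) (M : RTT n m) →
    (∀ T → f T ≡ runRTT M T) →
    Σ Ty λ A → Σ Tm λ t →
    ([] ⊢ t ∶ ((BT n [ A ]ty) ⇒ BT m)) ×
    (∀ (T : BinTree n) → app t (encode n T) =β encode m (f T))
theorem34 n m f M f≡M = Cfg , transducerTm , transducerTm-⊢ , λ T →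
  ≡-subst (λ U → app transducerTm (encode n T) =β encode m U) (sym (f≡M T)) (transducer-correct T)
  where open Encoding M
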